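{- Let $\mathcal R^{\mathsf{fip}}=\mathcal R(\mathsf{fip},\gamma^{\max})$, let $r\in\mathcal R^{\mathsf{fip}}$, and let $\varphi$ be a formula. If $(\mathcal R^{\mathsf{fip}},r,t)\vDash K_{i_0}\varphi$ and there is a centipede for $\langle i_0,\ldots,i_k\rangle$ in $(r,t..t')$, then $(\mathcal R^{\mathsf{fip}},r,t')\vDash K_{i_k}K_{i_{k-1}}\cdots K_{i_1}K_{i_0}\big(@_t K_{i_0}\varphi\big)$.
   Context: Model: a finite set of processes communicates over a directed network; each channel $i\to j$ has a known integer upper bound $b_{ij}\ge 1$ on transmission time. Time is global and discrete, and every local state contains the current time. In $\gamma^{\max}$, a message sent on $i\to j$ at time $s$ is received at a nondeterministically chosen time in $[s+1,s+b_{ij}]$; processes may receive external inputs, chosen nondeterministically and independently of the past. $\mathcal R(P,\gamma^{\max})$ is the set of all runs of protocol $P$. A node $(i,t)$ is process $i$ at time $t$; $r_i(t)$ is $i$'s local state at time $t$ in $r$. Full-information protocol $\mathsf{fip}$: every process sends its local state on each of its outgoing channels at every time step, and retains a history of every local event and every message received, with their times. Knowledge: $(\mathcal R,r,t)\vDash K_i\varphi$ iff $(\mathcal R,r',t)\vDash\varphi$ for all $r'\in\mathcal R$ with $r'_i(t)=r_i(t)$. Timestamp operator: $(\mathcal R,r,s)\vDash @_t\varphi$ iff $(\mathcal R,r,t)\vDash\varphi$. $D(i,j)$: weighted shortest-path distance (weights $b_{ij}$, $D(i,i)=0$). Bound guarantee: $(i,t)\dashrightarrow(j,t')$ iff $t+D(i,j)\le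 t'$. Syncausality $\rightsquigarrow$ in $r$: the smallest relation on nodes with (1) $(i,t)\rightsquigarrow(i,t')$ if $t\le t'$; (2) $(i,t)\rightsquigarrow(j,t')$ if a message sent at $(i,t)$ is received at $(j,t')$; (3) $(i,t)\rightsquigarrow(j,t+b_{ij})$ if $j$ is a neighbour of $i$ and $i$ sends no message to $j$ at time $t$; (4) transitivity. Centipede for $\langle i_0,\ldots,i_k\rangle$ in $(r,t..t')$ ($t\le t'$): nodes $\theta_0\rightsquigarrow\cdots\rightsquigarrow\theta_k$ in $r$ with $\theta_0=(i_0,t)$, $\theta_k=(i_k,t')$ and $\theta_h\dashrightarrow(i_h,t')$ for $h=1,\ldots,k-1$. -}

module Defs where

open import Data.Nat using (ℕ; zero; suc; _+_; _∸_; _≤_; _<_; _≟_)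
open import Data.Bool using (Bool; T)
open import Data.Bool.Properties using (T?)
open import Data.Fin using (Fin; toℕ; fromℕ; inject₁) renaming (zero to fzero; suc to fsuc)
open import Data.List using (List; []; _∷_; concatMap; upTo; allFin)
open import Data.Vec using (Vec; lookup; toList)
open import Data.Maybe using (Maybe)
open import Data.Product using (Σ; ∃; _×_; _,_)
open import Data.Unit using (⊤)
open import Relation.Nullary using (¬_; Dec; yes; no)
open import Relation.Binary.PropositionalEquality using (_≡_)

-- A directed network of n processes; channel i → j exists iff T (edge i j),
-- and b i j is the upper bound on the transmission time on that channel.
record Network : Set where
  field
    n     : ℕ
    edge  : Fin n → Fin n → Bool
    b     : Fin n → Fin n → ℕ
    b-pos : ∀ i j → T (edge i j) → 1 ≤ b i j

module Model (N : Network) (Inp : Set) where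
  open Network N public

  Proc : Set
  Proc = Fin n

  -- A run of fip in γ^max is determined by the nondeterministic choices:
  -- the external input (if any) of each process at each time, and for every
  -- message sent on a channel i → j at time s its transmission delay
  -- d ∈ [1, b i j] (it is received at time s + d).
  record Run : Set where
    field
      input   : Proc → ℕ → Maybe Inp
      delay   : (i j : Proc) → T (edge i j) → ℕ → ℕ
      delay-≥ : ∀ i j (e : T (edge i j)) s → 1 ≤ delay i j e s
      delay-≤ : ∀ i j (e : T (edge i j)) s → delay i j e s ≤ b i j
  open Run public

  -- A local state at time 0 records the
  -- input at time 0; a local state at time t+1 records the previous local
  -- state (the whole history is retained), the current time, the input at
  -- time t+1 and the list of messages received at time t+1, each given as
  -- (sender, sender's local state at the sending time).
  data View : Set where
    init : Maybe Inp → View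
    step : View → ℕ → Maybe Inp → List (Proc × View) → View

  back : ℕ → View → View
  back zero v = v
  back (suc k) (init x) = init x
  back (suc k) (step p _ _ _) = back k p

  mutual
    state : Run → ℕ → Proc → View
    state r zero i = init (input r i 0)
    state r (suc t) i = step (state r t i) (suc t) (input r i (suc t)) (received r t i)

    -- messages received by i at time t+1: for each channel j → i and each
    -- sending time s ≤ t whose message arrives at t+1, the content is the
    -- sender's local state at time s (fip sends its local state every step)
    received : Run → ℕ → Proc → List (Proc × View)
    received r t i =
      concatMap (λ j → concatMap (λ s → entry r t i j s (T? (edge j i))) (upTo (suc t))) (allFin n)

    entry : Run → ℕ → (i j : Proc) → ℕ → Dec (T (edge j i)) → List (Proc × View)
    entry r t i j s (no _) = []
    entry r t i j s (yes e) with suc t ≟ s + delay r j i e s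
    ... | yes _ = (j , back (t ∸ s) (state r t j)) ∷ []
    ... | no _  = []

  -- Facts / formulas, interpreted over the system R^fip = all runs.
  Fact : Set₁
  Fact = Run → ℕ → Set

  K : Proc → Fact → Fact
  K i φ r t = ∀ (r' : Run) → state r' t i ≡ state r t i → φ r' t

  At : ℕ → Fact → Fact
  At t φ r s = φ r t

  -- KSeq (i₀ ∷ i₁ ∷ … ∷ i_k ∷ []) φ  =  K_{i_k} … K_{i₁} K_{i₀} φ
  KSeq : List Proc → Fact → Fact
  KSeq [] φ = φ
  KSeq (i ∷ is) φ = KSeq is (K i φ)

  Node : Set
  Node = Proc × ℕ

  data Path : Proc → Proc → ℕ → Set where
    here  : ∀ {i} → Path i i 0
    there : ∀ {i j k w} → T (edge i j) → Path j k w → Path i k (b i j + w)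

  IsDist : Proc → Proc → ℕ → Set
  IsDist i j d = Path i j d × (∀ w → Path i j w → d ≤ w)

  -- bound guarantee (i,t) ⇢ (j,t')  iff  t + D(i,j) ≤ t'
  -- (if j is unreachable from i, D(i,j) = ∞ and this never holds)
  _⇢_ : Node → Node → Set
  (i , t) ⇢ (j , t') = ∃ λ d → IsDist i j d × (t + d ≤ t')

  -- in fip, every process sends a message on each outgoing channel at every time
  Sends : Run → Proc → Proc → ℕ → Set
  Sends r i j t = T (edge i j)

  data Syn (r : Run) : Node → Node → Set where
    local : ∀ {i t t'} → t ≤ t' → Syn r (i , t) (i , t')
    msg   : ∀ {i j t t'} (e : T (edge i j)) → t' ≡ t + delay r i j e t →
            Syn r (i , t) (j , t')
    nomsg : ∀ {i j t} → T (edge i j) → ¬ Sends r i j t →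
            Syn r (i , t) (j , t + b i j)
    trans : ∀ {θ₁ θ₂ θ₃} → Syn r θ₁ θ₂ → Syn r θ₂ θ₃ → Syn r θ₁ θ₃

  record Centipede (r : Run) {k : ℕ} (is : Vec Proc (suc k)) (t t' : ℕ) : Set where
    field
      t≤t'  : t ≤ t'
      θ     : Fin (suc k) → Node
      first : θ fzero ≡ (lookup is fzero , t)
      last  : θ (fromℕ k) ≡ (lookup is (fromℕ k) , t')
      chain : ∀ (h : Fin k) → Syn r (θ (inject₁ h)) (θ (fsuc h))
      legs  : ∀ (h : Fin (suc k)) → 1 ≤ toℕ h → toℕ h < k →
              θ h ⇢ (lookup is h , t')

module Submission where

-- Say that a node θ is recorded at a node θ' when any two runs whose local
-- states agree at θ' also agree at θ.  The proof has two halves.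
--
-- Local states contain their own
--    history (perfect recall), and every received message is the sender's
--    genuine local state at the sending time.  Hence a node is recorded at
--    every node it syncausally precedes (in the run at hand), and along a
--    bound guarantee (i,t) ⇢ (j,t') the node (i,t) is recorded at (j,t')
--    in every run, since along a shortest path each hop arrives in time.
--
-- If K_i ψ holds at t' in all runs agreeing with r
--    at θ, and θ ⇝ θ' where θ' is recorded at (i',t'), then K_{i'} K_i ψ
--    holds at t' in all runs agreeing with r at θ'.  Starting from θ₀ with
--    ψ = @_t K_{i₀} φ and walking along the centipede, whose legs are bound
--    guarantees, yields the theorem at the last node θ_k = (i_k,t').

open import Defs
open import Data.Nat using (ℕ; suc; zero; _+_; _∸_; _≤_; _≟_; s≤s; z≤n)
open import Data.Nat.Properties
  using (≤-refl; ≤-trans; m≤m+n; +-monoʳ-≤; +-assoc; +-suc; m∸n+n≡m; m+[n∸m]≡n; ≤-pred; m≤n⇒m<n∨m≡n)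
open import Data.Fin using (Fin; toℕ; fromℕ; inject₁) renaming (zero to fzero; suc to fsuc)
open import Data.Fin.Properties using (toℕ-fromℕ; toℕ-injective; toℕ≤pred[n])
open import Data.Vec using (Vec; lookup; toList; _∷_; [])
open import Data.Bool using (T)
open import Data.Bool.Properties using (T?; T-irrelevant)
open import Data.List using (List; []; upTo; allFin)
open import Data.List.Membership.Propositional using (_∈_; find; lose)
open import Data.List.Membership.Propositional.Properties
  using (∈-concatMap⁺; ∈-concatMap⁻; ∈-upTo⁺; ∈-upTo⁻; ∈-allFin)
open import Data.List.Relation.Unary.Any using (here)
open import Data.Product using (∃; _×_; _,_)
open import Data.Sum using (inj₁; inj₂)
open import Data.Empty using (⊥-elim)
open import Relation.Nullary using (yes; no)
open import Relation.Binary.PropositionalEquality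
  using (_≡_; refl; sym; cong; subst; module ≡-Reasoning)
  renaming (trans to ≡-trans)

module FullInformation (N : Network) (Inp : Set) where
  open Model N Inp
  open ≡-Reasoning

  stateAt : Run → Node → View
  stateAt ρ (i , s) = state ρ s i

  Agree : Run → Run → Node → Set
  Agree ρ ρ' θ = stateAt ρ θ ≡ stateAt ρ' θ

  _⊑_ : Node → Node → Set
  θ ⊑ θ' = ∀ ρ ρ' → Agree ρ ρ' θ' → Agree ρ ρ' θ

  time : View → ℕ
  time (init _) = 0
  time (step _ u _ _) = u

  time-state : ∀ ρ s i → time (state ρ s i) ≡ s
  time-state ρ zero i = refl
  time-state ρ (suc s) i = refl

  back-state : ∀ ρ i {s u} → s ≤ u → back (u ∸ s) (state ρ u i) ≡ state ρ s i
  back-state ρ i {s} {u} s≤u =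
    subst (λ v → back (u ∸ s) (state ρ v i) ≡ state ρ s i) (m∸n+n≡m s≤u) (back-+ (u ∸ s))
    where
    back-+ : ∀ m → back m (state ρ (m + s) i) ≡ state ρ s i
    back-+ zero = refl
    back-+ (suc m) = back-+ m

  perfect-recall : ∀ i {s u} → s ≤ u → (i , s) ⊑ (i , u)
  perfect-recall i {s} {u} s≤u ρ ρ' agree = begin
    state ρ s i                   ≡⟨ sym (back-state ρ i s≤u) ⟩
    back (u ∸ s) (state ρ u i)    ≡⟨ cong (back (u ∸ s)) agree ⟩
    back (u ∸ s) (state ρ' u i)   ≡⟨ back-state ρ' i s≤u ⟩
    state ρ' s i                  ∎

  inbox : View → List (Proc × View)
  inbox (init _) = []
  inbox (step _ _ _ ms) = ms

  entry-sound : ∀ ρ t q j s d {x} → s ≤ t → x ∈ entry ρ t q j s d → x ≡ (j , state ρ s j)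
  entry-sound ρ t q j s (no _) s≤t ()
  entry-sound ρ t q j s (yes e) s≤t x∈ with suc t ≟ s + delay ρ j q e s
  entry-sound ρ t q j s (yes e) s≤t (here refl) | yes _ = cong (j ,_) (back-state ρ j s≤t)
  entry-sound ρ t q j s (yes e) s≤t ()          | no _

  received-sound : ∀ ρ t q {p v} → (p , v) ∈ received ρ t q → v ≡ state ρ (time v) p
  received-sound ρ t q {p} {v} p,v∈ with find (∈-concatMap⁻ _ {xs = allFin n} p,v∈)
  ... | j , _ , ∈j with find (∈-concatMap⁻ _ {xs = upTo (suc t)} ∈j)
  ... | s , s∈ , ∈s with entry-sound ρ t q j s (T? (edge j q)) (≤-pred (∈-upTo⁻ s∈)) ∈s
  ... | refl = cong (λ z → state ρ z p) (sym (time-state ρ s p))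

  receipt-recorded : ∀ ρ ρ' p q s a → (p , state ρ s p) ∈ received ρ a q →
                     Agree ρ ρ' (q , suc a) → Agree ρ ρ' (p , s)
  receipt-recorded ρ ρ' p q s a received-msg agree = begin
    state ρ s p                     ≡⟨ received-sound ρ' a q (subst ((p , state ρ s p) ∈_) same-inbox received-msg) ⟩
    state ρ' (time (state ρ s p)) p ≡⟨ cong (λ z → state ρ' z p) (time-state ρ s p) ⟩
    state ρ' s p                    ∎
    where
    same-inbox : received ρ a q ≡ received ρ' a q
    same-inbox = cong inbox agree

  arrival : ∀ ρ p q (e : T (edge p q)) s → ∃ λ a → s ≤ a × suc a ≡ s + delay ρ p q e s
  arrival ρ p q e s = s + (d ∸ 1) , m≤m+n s (d ∸ 1) , arrives
    where
    d = delay ρ p q e s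
    arrives : suc (s + (d ∸ 1)) ≡ s + d
    arrives = begin
      suc (s + (d ∸ 1))  ≡⟨ sym (+-suc s (d ∸ 1)) ⟩
      s + suc (d ∸ 1)    ≡⟨ cong (s +_) (m+[n∸m]≡n (delay-≥ ρ p q e s)) ⟩
      s + d              ∎

  entry-complete : ∀ ρ p q (e : T (edge p q)) s a → suc a ≡ s + delay ρ p q e s → s ≤ a →
                   (p , state ρ s p) ∈ entry ρ a q p s (T? (edge p q))
  entry-complete ρ p q e s a arrives s≤a with T? (edge p q)
  ... | no ¬e = ⊥-elim (¬e e)
  ... | yes e' with T-irrelevant e e'
  ... | refl with suc a ≟ s + delay ρ p q e s
  ...   | yes _ = here (cong (p ,_) (sym (back-state ρ p s≤a)))
  ...   | no ¬arrives = ⊥-elim (¬arrives arrives)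

  sent-is-received : ∀ ρ p q (e : T (edge p q)) s a → suc a ≡ s + delay ρ p q e s → s ≤ a →
                     (p , state ρ s p) ∈ received ρ a q
  sent-is-received ρ p q e s a arrives s≤a =
    ∈-concatMap⁺ _ (lose (∈-allFin p)
      (∈-concatMap⁺ _ (lose (∈-upTo⁺ (s≤s s≤a)) (entry-complete ρ p q e s a arrives s≤a))))

  delivery-recorded : ∀ ρ ρ' p q (e : T (edge p q)) s u → s + delay ρ p q e s ≤ u →
                      Agree ρ ρ' (q , u) → Agree ρ ρ' (p , s)
  delivery-recorded ρ ρ' p q e s u arrived agree with arrival ρ p q e s
  ... | a , s≤a , arrives =
    receipt-recorded ρ ρ' p q s a (sent-is-received ρ p q e s a arrives s≤a)
      (perfect-recall q (subst (_≤ u) (sym arrives) arrived) ρ ρ' agree)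

  -- Syncausality in ρ: θ ⇝ θ' implies θ is recorded at θ' (for ρ and any ρ').
  -- Case (3) cannot occur since fip sends on every channel at every time.
  syncausal-recorded : ∀ ρ ρ' {θ θ'} → Syn ρ θ θ' → Agree ρ ρ' θ' → Agree ρ ρ' θ
  syncausal-recorded ρ ρ' (local s≤u) = perfect-recall _ s≤u ρ ρ'
  syncausal-recorded ρ ρ' (msg e refl) = delivery-recorded ρ ρ' _ _ e _ _ ≤-refl
  syncausal-recorded ρ ρ' (nomsg e ¬sends) = ⊥-elim (¬sends e)
  syncausal-recorded ρ ρ' (trans θ⇝θ₂ θ₂⇝θ') agree =
    syncausal-recorded ρ ρ' θ⇝θ₂ (syncausal-recorded ρ ρ' θ₂⇝θ' agree)

  -- Along a walk of weight w every message arrives in time, whatever the run.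
  path-recorded : ∀ {p q w} → Path p q w → ∀ s u → s + w ≤ u → (p , s) ⊑ (q , u)
  path-recorded here s u s+0≤u = perfect-recall _ (≤-trans (m≤m+n s 0) s+0≤u)
  path-recorded {p} (there {j = j} {w = w} e walk) s u s+w≤u ρ ρ' agree =
    delivery-recorded ρ ρ' p j e s (s + b p j) (+-monoʳ-≤ s (delay-≤ ρ p j e s))
      (path-recorded walk (s + b p j) u (subst (_≤ u) (sym (+-assoc s (b p j) w)) s+w≤u) ρ ρ' agree)

  bound-guarantee-recorded : ∀ {θ θ'} → θ ⇢ θ' → θ ⊑ θ'
  bound-guarantee-recorded (d , (walk , _) , s+d≤u) = path-recorded walk _ _ s+d≤u

  KnownFrom : Run → ℕ → Proc → Fact → Node → Set
  KnownFrom r t' i ψ θ = ∀ r' → Agree r' r θ → K i ψ r' t'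

  knowledge-step : ∀ {r t' i i' ψ θ θ'} → Syn r θ θ' → θ' ⊑ (i' , t') →
                   KnownFrom r t' i ψ θ → KnownFrom r t' i' (K i ψ) θ'
  knowledge-step {r} θ⇝θ' recorded known r' agree r'' indist =
    known r'' (sym (syncausal-recorded r r'' θ⇝θ' (≡-trans (sym agree) (recorded r' r'' (sym indist)))))

  knowledge-chain : ∀ r t' {k} (rest : Vec Proc k) (θ : Fin (suc k) → Node) i ψ →
                    (∀ h → Syn r (θ (inject₁ h)) (θ (fsuc h))) →
                    (∀ h → θ (fsuc h) ⊑ (lookup rest h , t')) →
                    KnownFrom r t' i ψ (θ fzero) → KSeq (toList rest) (K i ψ) r t'
  knowledge-chain r t' [] θ i ψ chain legs known = known r refl
  knowledge-chain r t' (i' ∷ rest) θ i ψ chain legs known =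
    knowledge-chain r t' rest (λ h → θ (fsuc h)) i' (K i ψ)
      (λ h → chain (fsuc h)) (λ h → legs (fsuc h))
      (knowledge-step {ψ = ψ} (chain fzero) (legs fzero) known)

  initial-knowledge : ∀ {r t t' i₀ φ} → K i₀ φ r t → t ≤ t' →
                      KnownFrom r t' i₀ (At t (K i₀ φ)) (i₀ , t)
  initial-knowledge {i₀ = i₀} knows t≤t' r' agree r'' indist r''' indist' =
    knows r''' (≡-trans indist' (≡-trans (perfect-recall i₀ t≤t' r'' r' indist) agree))

  -- Every node after the first of a centipede is recorded at (i_h, t'):
  -- inner nodes by their bound-guarantee legs, the last one since it is (i_k, t').
  centipede-recorded : ∀ {r k t t'} {is : Vec Proc (suc k)} (c : Centipede r is t t') →
                       ∀ h → Centipede.θ c (fsuc h) ⊑ (lookup is (fsuc h) , t')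
  centipede-recorded {k = k} {t' = t'} {is} c h with m≤n⇒m<n∨m≡n (toℕ≤pred[n] (fsuc h))
  ... | inj₁ inner = bound-guarantee-recorded (legs (fsuc h) (s≤s z≤n) inner)
    where open Centipede c
  ... | inj₂ final = subst (λ x → θ x ⊑ (lookup is x , t')) (sym is-last)
                       (subst (_⊑ (lookup is (fromℕ k) , t')) (sym last) (λ _ _ agree → agree))
    where
    open Centipede c
    is-last : fsuc h ≡ fromℕ k
    is-last = toℕ-injective (≡-trans final (sym (toℕ-fromℕ k)))

mainTheorem5 : (N : Network) (Inp : Set) → let open Model N Inp in
    ∀ (r : Run) (t t' : ℕ) (φ : Fact) (k : ℕ) (is : Vec Proc (suc k)) →
    K (lookup is fzero) φ r t →
    Centipede r is t t' →
    KSeq (toList is) (At t (K (lookup is fzero) φ)) r t'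
mainTheorem5 N Inp r t t' φ k (i₀ ∷ rest) knows c =
  knowledge-chain r t' rest θ i₀ (At t (K i₀ φ)) chain (centipede-recorded c) known-at-θ₀
  where
  open Model N Inp
  open FullInformation N Inp
  open Centipede c
  known-at-θ₀ : KnownFrom r t' i₀ (At t (K i₀ φ)) (θ fzero)
  known-at-θ₀ = subst (KnownFrom r t' i₀ (At t (K i₀ φ))) (sym first) (initial-knowledge {φ = φ} knows t≤t')
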